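{- Let $G_1$ and $G_2$ be graphs of orders $n_1$ and $n_2$, respectively, each containing at least one edge. Then \[\operatorname{Z}(G_1\Box G_2)\ge n_2\operatorname{Z}(G_1)-|E(\mathcal F_{G_1})|\,(n_2-\operatorname{Z}(G_2))+1,\] where $|E(\mathcal F_{G_1})|$ is the number of minimal forts of $G_1$.
   Context: All graphs are finite, simple and undirected with nonempty vertex sets. Zero forcing: given $B\subseteq V(G)$ initially filled, a filled vertex $u$ may force an unfilled vertex $w$ if $w$ is the only unfilled neighbor of $u$; $B$ is a zero forcing set if repeated forcing fills all vertices; $\operatorname{Z}(G)$ is the minimum size of a zero forcing set. A fort of $G$ is a nonempty $F\subseteq V(G)$ such that every $v\in V(G)\setminus F$ has $|N_G(v)\cap F|\neq 1$; a minimal fort is one not properly containing another fort. $\mathcal F_{G}$ denotes the hypergraph whose edges are the minimal forts of $G$. The Cartesian product $G\Box G'$ has vertex set $V(G)\times V(G')$, with $(u,u')\sim(v,v')$ iff ($u=v$ and $u'v'\in E(G')$) or ($u'=v'$ and $uv\in E(G)$). -}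

module Defs where

open import Data.Nat using (ℕ; _*_; _≤_)
open import Data.Bool using (Bool; true; false; _∧_; _∨_)
open import Data.Fin using (Fin; remQuot)
open import Data.Fin.Properties using (_≟_)
open import Data.Fin.Subset using (Subset; _∈_; _∉_; _⊆_; _∩_; ∣_∣)
open import Data.Vec using (tabulate)
open import Data.Product using (Σ; ∃; ∃-syntax; _×_; _,_; proj₁; proj₂)
open import Data.List using (List; length)
open import Data.List.Relation.Unary.Unique.Propositional using (Unique)
import Data.List.Membership.Propositional as L
open import Relation.Nullary using (¬_; ⌊_⌋)
open import Relation.Binary.PropositionalEquality using (_≡_; _≢_)

Graph : ℕ → Set
Graph n = Fin n → Fin n → Bool

IsSimple : {n : ℕ} → Graph n → Set
IsSimple {n} G = (∀ u v → G u v ≡ G v u) × (∀ v → G v v ≡ false)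

HasEdge : {n : ℕ} → Graph n → Set
HasEdge {n} G = ∃[ u ] ∃[ v ] (G u v ≡ true)

N : {n : ℕ} → Graph n → Fin n → Subset n
N G v = tabulate (G v)

data Filled {n : ℕ} (G : Graph n) (B : Subset n) : Fin n → Set where
  init  : ∀ {v} → v ∈ B → Filled G B v
  force : ∀ {u w} → Filled G B u → G u w ≡ true →
          (∀ x → G u x ≡ true → x ≢ w → Filled G B x) →
          Filled G B w

IsZeroForcingSet : {n : ℕ} → Graph n → Subset n → Set
IsZeroForcingSet G B = ∀ v → Filled G B v

IsZ : {n : ℕ} → Graph n → ℕ → Set
IsZ {n} G k =
  (∃[ B ] (IsZeroForcingSet G B × ∣ B ∣ ≡ k)) ×
  (∀ B → IsZeroForcingSet G B → k ≤ ∣ B ∣)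

IsFort : {n : ℕ} → Graph n → Subset n → Set
IsFort {n} G F = (∃[ v ] (v ∈ F)) × (∀ v → v ∉ F → ∣ N G v ∩ F ∣ ≢ 1)

IsMinimalFort : {n : ℕ} → Graph n → Subset n → Set
IsMinimalFort {n} G F =
  IsFort G F × (∀ F′ → F′ ⊆ F → IsFort G F′ → F′ ≡ F)

NumMinimalForts : {n : ℕ} → Graph n → ℕ → Set
NumMinimalForts {n} G m =
  Σ (List (Subset n)) λ L →
    Unique L × (∀ F → (F L.∈ L → IsMinimalFort G F) × (IsMinimalFort G F → F L.∈ L))
    × length L ≡ m

-- Cartesian product, vertex (a , b) encoded as combine a b : Fin (n₁ * n₂)

_□_ : {n₁ n₂ : ℕ} → Graph n₁ → Graph n₂ → Graph (n₁ * n₂)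
_□_ {n₁} {n₂} G H i j with remQuot n₂ i | remQuot n₂ j
... | (a , b) | (c , d) = (⌊ a ≟ c ⌋ ∧ H b d) ∨ (⌊ b ≟ d ⌋ ∧ G a c)

-- A set is zero forcing iff it meets every fort, equivalently every minimal fort.  Let B be a
-- zero forcing set of G₁ □ G₂ and C b ⊆ V(G₁) its layer over b ∈ V(G₂).  Adding to C b one
-- vertex of each minimal fort of G₁ missed by C b yields a zero forcing set of G₁, so
-- Z(G₁) ≤ |C b| + #(minimal forts missed by C b).  For a minimal fort F of G₁, the set of b with
-- C b meeting F is a zero forcing set of G₂, since F × F₂ is a fort of the product for every
-- fort F₂ of G₂; so at most n₂ − Z(G₂) layers miss F.  Summing the first bound over b and double
-- counting the pairs (F, b) with F missed by C b gives n₂ Z(G₁) ≤ |B| + m (n₂ − Z(G₂)).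
--
-- The +1 comes from the first force u = (a, b) → w among vertices with both coordinates
-- non-isolated: all other neighbours of u lie in B.  If w = (a, d), then C b contains the closed
-- neighbourhood of a, and dropping a neighbour of a keeps a zero forcing set, so the bound at b is
-- strict.  If w = (c, b) and a lies in a minimal fort F, the same happens in G₂ for b and the
-- layers meeting F; if a lies in no minimal fort, C b − a misses the same forts as C b.

module Submission where

open import Defs
open import Data.Nat using (ℕ)

module Counting where

  open import Data.Nat using (ℕ; zero; suc; _+_; _*_; _≤_; _<_; z≤n; s≤s)
  open import Data.Nat.Properties
    using (+-0-commutativeMonoid; +-mono-≤; +-mono-<-≤; +-mono-≤-<; +-monoʳ-≤; +-assoc; +-suc;
           suc-injective; *-identityʳ; ≤-refl; ≤-trans; ≤-reflexive)
  open import Data.Bool using (true; false; if_then_else_)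
  open import Data.Fin using (Fin; zero; suc; combine; _↑ˡ_; _↑ʳ_)
  open import Data.Fin.Properties using (any?)
  open import Data.Fin.Subset
  open import Data.Fin.Subset.Properties
  open import Data.Vec using (_∷_; []; tabulate)
  open import Data.Vec.Properties using (lookup∘tabulate; []=⇒lookup; lookup⇒[]=)
  open import Data.Product using (∃; _×_; _,_)
  open import Data.Sum using (inj₁; inj₂)
  open import Data.Empty using (⊥-elim)
  open import Function using (_∘_)
  open import Relation.Nullary using (Dec; yes; no; does; contradiction)
  open import Relation.Nullary.Decidable using (_×-dec_; ¬?)
  open import Relation.Unary using (Pred; Decidable)
  open import Relation.Binary.PropositionalEquality
  open import Algebra.Properties.CommutativeMonoid.Sum +-0-commutativeMonoid
    using (sum; sum-syntax; sum-cong-≗; ∑-distrib-+)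

  ∑-mono-≤ : ∀ {n} {f g : Fin n → ℕ} → (∀ i → f i ≤ g i) → ∑[ i < n ] f i ≤ ∑[ i < n ] g i
  ∑-mono-≤ {zero}  f≤g = z≤n
  ∑-mono-≤ {suc n} f≤g = +-mono-≤ (f≤g zero) (∑-mono-≤ (f≤g ∘ suc))

  ∑-mono-< : ∀ {n} {f g : Fin n → ℕ} → (∀ i → f i ≤ g i) → ∀ j → f j < g j →
             ∑[ i < n ] f i < ∑[ i < n ] g i
  ∑-mono-< f≤g zero    fj<gj = +-mono-<-≤ fj<gj (∑-mono-≤ (f≤g ∘ suc))
  ∑-mono-< f≤g (suc j) fj<gj = +-mono-≤-< (f≤g zero) (∑-mono-< (f≤g ∘ suc) j fj<gj)

  ∑-const : ∀ n c → ∑[ i < n ] c ≡ n * c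
  ∑-const zero    c = refl
  ∑-const (suc n) c = cong (c +_) (∑-const n c)

  ∑-↑ : ∀ m {n} (f : Fin (m + n) → ℕ) →
        ∑[ i < m + n ] f i ≡ ∑[ i < m ] f (i ↑ˡ n) + ∑[ j < n ] f (m ↑ʳ j)
  ∑-↑ zero    f = refl
  ∑-↑ (suc m) f = trans (cong (f zero +_) (∑-↑ m (f ∘ suc))) (sym (+-assoc (f zero) _ _))

  ∑-combine : ∀ m {n} (f : Fin (m * n) → ℕ) →
              ∑[ i < m * n ] f i ≡ ∑[ a < m ] ∑[ b < n ] f (combine a b)
  ∑-combine zero    f = refl
  ∑-combine (suc m) {n} f =
    trans (∑-↑ n f) (cong (∑[ b < n ] f (b ↑ˡ (m * n)) +_) (∑-combine m (f ∘ (n ↑ʳ_))))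

  indicator : ∀ {a} {A : Set a} → Dec A → ℕ
  indicator a? = if does a? then 1 else 0

  indicator-mono : ∀ {a b} {A : Set a} {B : Set b} (a? : Dec A) (b? : Dec B) →
                   (A → B) → indicator a? ≤ indicator b?
  indicator-mono a? b? A→B with a? | b?
  ... | yes a | yes _ = ≤-refl
  ... | yes a | no ¬b = contradiction (A→B a) ¬b
  ... | no _  | _     = z≤n

  select : ∀ {n p} {P : Pred (Fin n) p} → Decidable P → Subset n
  select P? = tabulate (does ∘ P?)

  module _ {n p} {P : Pred (Fin n) p} (P? : Decidable P) where

    ∈-select⁺ : ∀ {x} → P x → x ∈ select P?
    ∈-select⁺ {x} px with P? x in eq
    ... | yes _ = lookup⇒[]= x (select P?) (trans (lookup∘tabulate _ x) (cong does eq))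
    ... | no ¬px = ⊥-elim (¬px px)

    ∈-select⁻ : ∀ {x} → x ∈ select P? → P x
    ∈-select⁻ {x} x∈ with P? x | trans (sym (lookup∘tabulate (does ∘ P?) x)) ([]=⇒lookup x∈)
    ... | yes px | _  = px
    ... | no _   | ()

  ∣select∣≡∑ : ∀ {n p} {P : Pred (Fin n) p} (P? : Decidable P) →
               ∣ select P? ∣ ≡ ∑[ i < n ] indicator (P? i)
  ∣select∣≡∑ {zero}  P? = refl
  ∣select∣≡∑ {suc n} P? with P? zero
  ... | yes _ = cong suc (∣select∣≡∑ (P? ∘ suc))
  ... | no _  = ∣select∣≡∑ (P? ∘ suc)

  ∑indicator¬+∣select∣≡n : ∀ {n p} {P : Pred (Fin n) p} (P? : Decidable P) →
                           ∑[ i < n ] indicator (¬? (P? i)) + ∣ select P? ∣ ≡ n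
  ∑indicator¬+∣select∣≡n {n} P? = begin
    ∑[ i < n ] ¬P i + ∣ select P? ∣                  ≡⟨ cong (∑[ i < n ] ¬P i +_) (∣select∣≡∑ P?) ⟩
    ∑[ i < n ] ¬P i + ∑[ i < n ] indicator (P? i)    ≡⟨ ∑-distrib-+ ¬P (indicator ∘ P?) ⟨
    ∑[ i < n ] (¬P i + indicator (P? i))             ≡⟨ sum-cong-≗ (complementary ∘ P?) ⟩
    ∑[ i < n ] 1                                     ≡⟨ ∑-const n 1 ⟩
    n * 1                                            ≡⟨ *-identityʳ n ⟩
    n                                                ∎
    where
    open ≡-Reasoning
    ¬P : Fin n → ℕ
    ¬P i = indicator (¬? (P? i))
    complementary : ∀ {a} {A : Set a} (a? : Dec A) → indicator (¬? a?) + indicator a? ≡ 1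
    complementary a? with does a?
    ... | true  = refl
    ... | false = refl

  select-∈? : ∀ {n} (p : Subset n) → select (_∈? p) ≡ p
  select-∈? p = ⊆-antisym (∈-select⁻ (_∈? p)) (∈-select⁺ (_∈? p))

  ∣p∣≡∑ : ∀ {n} (p : Subset n) → ∣ p ∣ ≡ ∑[ i < n ] indicator (i ∈? p)
  ∣p∣≡∑ p = trans (cong ∣_∣ (sym (select-∈? p))) (∣select∣≡∑ (_∈? p))

  ∣p∣≡0⇒p≡⊥ : ∀ {n} (p : Subset n) → ∣ p ∣ ≡ 0 → p ≡ ⊥
  ∣p∣≡0⇒p≡⊥ []            _     = refl
  ∣p∣≡0⇒p≡⊥ (outside ∷ p) ∣p∣≡0 = cong (outside ∷_) (∣p∣≡0⇒p≡⊥ p ∣p∣≡0)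

  ∣p∣≡1⇒p≡⁅x⁆ : ∀ {n} (p : Subset n) → ∣ p ∣ ≡ 1 → ∃ λ x → p ≡ ⁅ x ⁆
  ∣p∣≡1⇒p≡⁅x⁆ (inside  ∷ p) ∣p∣≡1 = zero , cong (inside ∷_) (∣p∣≡0⇒p≡⊥ p (suc-injective ∣p∣≡1))
  ∣p∣≡1⇒p≡⁅x⁆ (outside ∷ p) ∣p∣≡1 with ∣p∣≡1⇒p≡⁅x⁆ p ∣p∣≡1
  ... | x , p≡⁅x⁆ = suc x , cong (outside ∷_) p≡⁅x⁆

  p≡⁅x⁆ : ∀ {n} {p : Subset n} {x} → x ∈ p → (∀ {y} → y ∈ p → y ≡ x) → p ≡ ⁅ x ⁆
  p≡⁅x⁆ {p = p} {x} x∈p unique = ⊆-antisym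
    (λ y∈p → subst (_∈ ⁅ x ⁆) (sym (unique y∈p)) (x∈⁅x⁆ x))
    (λ y∈⁅x⁆ → subst (_∈ p) (sym (x∈⁅y⁆⇒x≡y x y∈⁅x⁆)) x∈p)

  ∣p∪q∣≤∣p∣+∣q∣ : ∀ {n} (p q : Subset n) → ∣ p ∪ q ∣ ≤ ∣ p ∣ + ∣ q ∣
  ∣p∪q∣≤∣p∣+∣q∣ []            []            = z≤n
  ∣p∪q∣≤∣p∣+∣q∣ (inside  ∷ p) (s ∷ q)       =
    s≤s (≤-trans (∣p∪q∣≤∣p∣+∣q∣ p q) (+-monoʳ-≤ ∣ p ∣ (∣p∣≤∣x∷p∣ s q)))
  ∣p∪q∣≤∣p∣+∣q∣ (outside ∷ p) (inside  ∷ q) =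
    ≤-trans (s≤s (∣p∪q∣≤∣p∣+∣q∣ p q)) (≤-reflexive (sym (+-suc ∣ p ∣ ∣ q ∣)))
  ∣p∪q∣≤∣p∣+∣q∣ (outside ∷ p) (outside ∷ q) = ∣p∪q∣≤∣p∣+∣q∣ p q

  _meets_ : ∀ {n} → Subset n → Subset n → Set
  F meets T = ∃ λ x → x ∈ F × x ∈ T

  _meets?_ : ∀ {n} (F T : Subset n) → Dec (F meets T)
  F meets? T = any? (λ x → x ∈? F ×-dec x ∈? T)

  missedBy : ∀ {m n} → (Fin m → Subset n) → Subset n → ℕ
  missedBy {m} F C = ∑[ k < m ] indicator (¬? (F k meets? C))

  missedBy-anti : ∀ {m n} (F : Fin m → Subset n) {C C′} → (∀ k → F k meets C → F k meets C′) →
                  missedBy F C′ ≤ missedBy F C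
  missedBy-anti F C⇒C′ =
    ∑-mono-≤ λ k → indicator-mono (¬? (F k meets? _)) (¬? (F k meets? _)) λ ¬C′ C → ¬C′ (C⇒C′ k C)

  transversal : ∀ {m n} (F : Fin m → Subset n) (C : Subset n) → (∀ k → Nonempty (F k)) →
                ∃ λ R → ∣ R ∣ ≤ missedBy F C × (∀ k → F k meets (C ∪ R))
  transversal {zero} {n} F C nonempty = ⊥ , ≤-reflexive (∣⊥∣≡0 n) , λ ()
  transversal {suc m} F C nonempty
    with transversal (F ∘ suc) C (nonempty ∘ suc) | F zero meets? C | nonempty zero
  ... | R , ∣R∣≤ , hits | yes (y , y∈F₀ , y∈C) | _ = R , ∣R∣≤ , λ
    { zero    → y , y∈F₀ , p⊆p∪q R y∈C
    ; (suc k) → hits k }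
  ... | R , ∣R∣≤ , hits | no _ | x , x∈F₀ = ⁅ x ⁆ ∪ R , ∣⁅x⁆∪R∣≤ , λ
    { zero    → x , x∈F₀ , q⊆p∪q C _ (p⊆p∪q R (x∈⁅x⁆ x))
    ; (suc k) → grow (hits k) }
    where
    ∣⁅x⁆∪R∣≤ : ∣ ⁅ x ⁆ ∪ R ∣ ≤ suc (missedBy (F ∘ suc) C)
    ∣⁅x⁆∪R∣≤ = ≤-trans (∣p∪q∣≤∣p∣+∣q∣ ⁅ x ⁆ R)
                       (≤-trans (≤-reflexive (cong (_+ ∣ R ∣) (∣⁅x⁆∣≡1 x))) (s≤s ∣R∣≤))
    grow : ∀ {A} → A meets (C ∪ R) → A meets (C ∪ (⁅ x ⁆ ∪ R))
    grow (y , y∈A , y∈C∪R) with x∈p∪q⁻ C R y∈C∪R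
    ... | inj₁ y∈C = y , y∈A , p⊆p∪q _ y∈C
    ... | inj₂ y∈R = y , y∈A , q⊆p∪q C _ (q⊆p∪q ⁅ x ⁆ R y∈R)

module ZeroForcing where

  open Counting
  open import Data.Nat using (ℕ; zero; suc; _+_; _≤_; _<_)
  import Data.Nat as ℕ
  open import Data.Nat.Properties
    using (≤-antisym; ≤-trans; <-≤-trans; ≤-<-trans; +-suc; +-monoʳ-≤; +-mono-<-≤;
           ≤-reflexive; ≤-pred; m≤m+n; ≤-refl)
  open import Data.Bool using (true; false)
  import Data.Bool as Bool
  open import Data.Fin using (Fin; zero; suc; _≟_)
  open import Data.Fin.Properties using (all?; any?; ¬∀⟶∃¬)
  open import Data.Fin.Subset
  open import Data.Fin.Subset.Properties
  open import Data.Vec.Properties using (lookup∘tabulate; []=⇒lookup; lookup⇒[]=)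
  open import Data.Product using (∃; ∃₂; _×_; _,_; proj₁; proj₂)
  open import Data.Sum using (_⊎_; inj₁; inj₂)
  open import Data.Empty using (⊥-elim)
  open import Function using (_∘_)
  open import Relation.Nullary using (Dec; yes; no; ¬_; contradiction)
  open import Relation.Nullary.Decidable using (¬?; _×-dec_; _→-dec_; decidable-stable)
  open import Relation.Binary.PropositionalEquality

  module _ {n} (G : Graph n) where

    ∈N⁺ : ∀ {v w} → G v w ≡ true → w ∈ N G v
    ∈N⁺ {v} {w} e = lookup⇒[]= w (N G v) (trans (lookup∘tabulate (G v) w) e)

    ∈N⁻ : ∀ {v w} → w ∈ N G v → G v w ≡ true
    ∈N⁻ {v} {w} w∈ = trans (sym (lookup∘tabulate (G v) w)) ([]=⇒lookup w∈)

    UniqueNeighbourIn : Fin n → Subset n → Fin n → Set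
    UniqueNeighbourIn v F w = G v w ≡ true × w ∈ F × (∀ {y} → G v y ≡ true → y ∈ F → y ≡ w)

    uniqueNeighbour⇒∣N∩F∣≡1 : ∀ {v F w} → UniqueNeighbourIn v F w → ∣ N G v ∩ F ∣ ≡ 1
    uniqueNeighbour⇒∣N∩F∣≡1 {v} {F} {w} (vw , w∈F , unique) =
      trans (cong ∣_∣ (p≡⁅x⁆ (x∈p∩q⁺ (∈N⁺ vw , w∈F)) only-w)) (∣⁅x⁆∣≡1 w)
      where
      only-w : ∀ {y} → y ∈ N G v ∩ F → y ≡ w
      only-w y∈ with x∈p∩q⁻ (N G v) F y∈
      ... | y∈N , y∈F = unique (∈N⁻ y∈N) y∈F

    ∣N∩F∣≡1⇒uniqueNeighbour : ∀ {v F} → ∣ N G v ∩ F ∣ ≡ 1 → ∃ (UniqueNeighbourIn v F)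
    ∣N∩F∣≡1⇒uniqueNeighbour {v} {F} ∣N∩F∣≡1 with ∣p∣≡1⇒p≡⁅x⁆ (N G v ∩ F) ∣N∩F∣≡1
    ... | w , N∩F≡⁅w⁆ = w , ∈N⁻ (proj₁ w∈N∩F) , proj₂ w∈N∩F , unique
      where
      w∈N∩F : w ∈ N G v × w ∈ F
      w∈N∩F = x∈p∩q⁻ (N G v) F (subst (w ∈_) (sym N∩F≡⁅w⁆) (x∈⁅x⁆ w))
      unique : ∀ {y} → G v y ≡ true → y ∈ F → y ≡ w
      unique vy y∈F = x∈⁅y⁆⇒x≡y w (subst (_ ∈_) N∩F≡⁅w⁆ (x∈p∩q⁺ (∈N⁺ vy , y∈F)))

    private
      fortCondition? : ∀ F v → Dec (v ∉ F → ∣ N G v ∩ F ∣ ≢ 1)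
      fortCondition? F v = ¬? (v ∈? F) →-dec ¬? (∣ N G v ∩ F ∣ ℕ.≟ 1)

    isFort? : ∀ F → Dec (IsFort G F)
    isFort? F = nonempty? F ×-dec all? (fortCondition? F)

    nonFort⇒uniqueNeighbour : ∀ {F} → Nonempty F → ¬ IsFort G F → ∃₂ λ v w → v ∉ F × UniqueNeighbourIn v F w
    nonFort⇒uniqueNeighbour {F} nonempty ¬fort
      with ¬∀⟶∃¬ n _ (fortCondition? F) (λ closed → ¬fort (nonempty , closed))
    ... | v , ¬closed with ∣N∩F∣≡1⇒uniqueNeighbour ∣N∩F∣≡1
      where
      ∣N∩F∣≡1 : ∣ N G v ∩ F ∣ ≡ 1
      ∣N∩F∣≡1 = decidable-stable (∣ N G v ∩ F ∣ ℕ.≟ 1) λ ≢1 → ¬closed λ _ → ≢1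
    ...   | w , unique = v , w , (λ v∈F → ¬closed λ v∉F → contradiction v∈F v∉F) , unique

    Filled-trans : ∀ {B B′ v} → (∀ {u} → u ∈ B′ → Filled G B u) → Filled G B′ v → Filled G B v
    Filled-trans B′⊆B (init v∈B′)          = B′⊆B v∈B′
    Filled-trans B′⊆B (force u uw others) =
      force (Filled-trans B′⊆B u) uw (λ x ux x≢w → Filled-trans B′⊆B (others x ux x≢w))

    MeetsAllForts : Subset n → Set
    MeetsAllForts T = ∀ F → IsFort G F → F meets T

    zfs⇒meetsAllForts : ∀ {B} → IsZeroForcingSet G B → MeetsAllForts B
    zfs⇒meetsAllForts {B} zfs F ((v , v∈F) , fort) with F meets? B
    ... | yes F∩B = F∩B
    ... | no ¬F∩B = ⊥-elim (outsideF (zfs v) v∈F)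
      where
      outsideF : ∀ {v} → Filled G B v → v ∉ F
      outsideF (init v∈B) v∈F = ¬F∩B (_ , v∈F , v∈B)
      outsideF {w} (force {u} u-filled uw others) w∈F =
        fort u (outsideF u-filled) (uniqueNeighbour⇒∣N∩F∣≡1 (uw , w∈F , unique))
        where
        unique : ∀ {y} → G u y ≡ true → y ∈ F → y ≡ w
        unique {y} uy y∈F with y ≟ w
        ... | yes y≡w = y≡w
        ... | no y≢w  = ⊥-elim (outsideF (others y uy y≢w) y∈F)

    forcingStep : ∀ {T v} → MeetsAllForts T → v ∉ T → ∃ λ w → w ∉ T × Filled G T w
    forcingStep {T} {v} T-meets v∉T with isFort? (∁ T)
    ... | yes fort with T-meets (∁ T) fort
    ...   | x , x∈∁T , x∈T = ⊥-elim (x∈∁p⇒x∉p x∈∁T x∈T)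
    forcingStep {T} {v} T-meets v∉T | no ¬fort
      with nonFort⇒uniqueNeighbour (v , x∉p⇒x∈∁p v∉T) ¬fort
    ... | u , w , u∉∁T , uw , w∈∁T , unique =
      w , x∈∁p⇒x∉p w∈∁T , force (init (x∉∁p⇒x∈p u∉∁T)) uw others
      where
      others : ∀ x → G u x ≡ true → x ≢ w → Filled G T x
      others x ux x≢w with x ∈? T
      ... | yes x∈T = init x∈T
      ... | no x∉T  = ⊥-elim (x≢w (unique ux (x∉p⇒x∈∁p x∉T)))

    meetsAllForts⇒zfs : ∀ {T} → MeetsAllForts T → IsZeroForcingSet G T
    meetsAllForts⇒zfs {T} = grow n T (m≤m+n n ∣ T ∣)
      where
      grow : ∀ k T → n ≤ k + ∣ T ∣ → MeetsAllForts T → IsZeroForcingSet G T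
      grow k T n≤k+∣T∣ T-meets v with v ∈? T
      ... | yes v∈T = init v∈T
      ... | no v∉T with k
      ...   | zero = ⊥-elim (v∉T (subst (v ∈_) (sym (∣p∣≡n⇒p≡⊤ (≤-antisym (∣p∣≤n T) n≤k+∣T∣))) ∈⊤))
      ...   | suc k with forcingStep T-meets v∉T
      ...     | w , w∉T , w-filled = Filled-trans fromT′ (grow k T′ n≤k+∣T′∣ T′-meets v)
        where
        T′ = T ∪ ⁅ w ⁆
        T⊆T′ : T ⊆ T′
        T⊆T′ = p⊆p∪q ⁅ w ⁆
        n≤k+∣T′∣ : n ≤ k + ∣ T′ ∣
        n≤k+∣T′∣ = ≤-trans n≤k+∣T∣ (≤-trans (≤-reflexive (sym (+-suc k ∣ T ∣)))
                     (+-monoʳ-≤ k (p⊂q⇒∣p∣<∣q∣ (T⊆T′ , w , q⊆p∪q T ⁅ w ⁆ (x∈⁅x⁆ w) , w∉T))))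
        T′-meets : MeetsAllForts T′
        T′-meets F fort with T-meets F fort
        ... | x , x∈F , x∈T = x , x∈F , T⊆T′ x∈T
        fromT′ : ∀ {u} → u ∈ T′ → Filled G T u
        fromT′ {u} u∈T′ with x∈p∪q⁻ T ⁅ w ⁆ u∈T′
        ... | inj₁ u∈T  = init u∈T
        ... | inj₂ u∈⁅w⁆ = subst (Filled G T) (sym (x∈⁅y⁆⇒x≡y w u∈⁅w⁆)) w-filled

    ZAtLeast : ℕ → Set
    ZAtLeast z = ∀ B → IsZeroForcingSet G B → z ≤ ∣ B ∣

    meetsAllForts⇒z≤∣T∣ : ∀ {z T} → ZAtLeast z → MeetsAllForts T → z ≤ ∣ T ∣
    meetsAllForts⇒z≤∣T∣ {T = T} z≤ T-meets = z≤ T (meetsAllForts⇒zfs T-meets)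

    ClosedNeighbourhood⊆ : Fin n → Subset n → Set
    ClosedNeighbourhood⊆ u T = u ∈ T × (∀ {y} → G u y ≡ true → y ∈ T)

    zfs-removeNeighbour : ∀ {T u x} → G u u ≡ false → IsZeroForcingSet G T →
                          ClosedNeighbourhood⊆ u T → G u x ≡ true → IsZeroForcingSet G (T - x)
    zfs-removeNeighbour {T} {u} {x} uu zfs (u∈T , N[u]⊆T) ux v = Filled-trans fromT (zfs v)
      where
      u≢x : u ≢ x
      u≢x refl with () ← trans (sym ux) uu
      fromT : ∀ {y} → y ∈ T → Filled G (T - x) y
      fromT {y} y∈T with y ≟ x
      ... | no y≢x   = init (x∈p∧x≢y⇒x∈p-y y∈T y≢x)
      ... | yes refl = force (init (x∈p∧x≢y⇒x∈p-y u∈T u≢x)) ux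
                         λ y uy y≢x → init (x∈p∧x≢y⇒x∈p-y (N[u]⊆T uy) y≢x)

    closedNeighbourhood⊆zfs⇒z<∣T∣ : ∀ {z T u x} → ZAtLeast z → G u u ≡ false → IsZeroForcingSet G T →
                                    ClosedNeighbourhood⊆ u T → G u x ≡ true → z < ∣ T ∣
    closedNeighbourhood⊆zfs⇒z<∣T∣ {T = T} z≤ uu zfs N[u]⊆T ux =
      ≤-<-trans (z≤ (T - _) (zfs-removeNeighbour uu zfs N[u]⊆T ux)) (x∈p⇒∣p-x∣<∣p∣ (proj₂ N[u]⊆T ux))

    fort⇒minimalFort⊆ : ∀ {F} → IsFort G F → ∃ λ F′ → F′ ⊆ F × IsMinimalFort G F′
    fort⇒minimalFort⊆ {F} = shrink (suc ∣ F ∣) F ≤-refl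
      where
      shrink : ∀ k F → ∣ F ∣ < k → IsFort G F → ∃ λ F′ → F′ ⊆ F × IsMinimalFort G F′
      shrink (suc k) F ∣F∣≤k fort with anySubset? (λ F′ → F′ ⊂? F ×-dec isFort? F′)
      ... | yes (F′ , F′⊂F , fort′) with shrink k F′ (<-≤-trans (p⊂q⇒∣p∣<∣q∣ F′⊂F) (≤-pred ∣F∣≤k)) fort′
      ...   | F″ , F″⊆F′ , minimal = F″ , proj₁ F′⊂F ∘ F″⊆F′ , minimal
      shrink (suc k) F ∣F∣≤k fort | no ¬smaller = F , ⊆-refl , fort , minimal
        where
        minimal : ∀ F′ → F′ ⊆ F → IsFort G F′ → F′ ≡ F
        minimal F′ F′⊆F fort′ = ⊆-antisym F′⊆F λ {x} x∈F →
          decidable-stable (x ∈? F′) λ x∉F′ → ¬smaller (F′ , (F′⊆F , x , x∈F , x∉F′) , fort′)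

    meetsMinimalForts⇒meetsAllForts : ∀ {T} → (∀ F → IsMinimalFort G F → F meets T) → MeetsAllForts T
    meetsMinimalForts⇒meetsAllForts T-meets F fort with fort⇒minimalFort⊆ fort
    ... | F′ , F′⊆F , minimal with T-meets F′ minimal
    ...   | x , x∈F′ , x∈T = x , F′⊆F x∈F′ , x∈T

    InitialForce : Subset n → Fin n → Fin n → Set
    InitialForce B u w = u ∈ B × G u w ≡ true × (∀ {x} → G u x ≡ true → x ≢ w → x ∈ B)

    AdjacencyClosed : (Fin n → Set) → Set
    AdjacencyClosed W = ∀ {u v} → G u v ≡ true → (W u → W v) × (W v → W u)

    filled⇒initialForce : ∀ {W B v} → AdjacencyClosed W → Filled G B v → W v →
                          v ∈ B ⊎ ∃₂ λ u w → W u × InitialForce B u w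
    filled⇒initialForce closed (init v∈B) _ = inj₁ v∈B
    filled⇒initialForce {B = B} closed (force {u} {w} u-filled uw others) Ww
      with filled⇒initialForce closed u-filled (proj₂ (closed uw) Ww)
    ... | inj₂ initial = inj₂ initial
    ... | inj₁ u∈B with any? (λ x → (G u x Bool.≟ true) ×-dec ¬? (x ≟ w) ×-dec ¬? (x ∈? B))
    ...   | no ¬escape = inj₂ (u , w , proj₂ (closed uw) Ww , u∈B , uw , λ {x} ux x≢w →
              decidable-stable (x ∈? B) λ x∉B → ¬escape (x , ux , x≢w , x∉B))
    ...   | yes (x , ux , x≢w , x∉B)
      with filled⇒initialForce closed (others x ux x≢w) (proj₁ (closed ux) (proj₂ (closed uw) Ww))
    ...     | inj₁ x∈B    = contradiction x∈B x∉B
    ...     | inj₂ initial = inj₂ initial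

    NonIsolated : Fin n → Set
    NonIsolated v = ∃ λ w → G v w ≡ true

  module LayerBound {m n} (G : Graph n) (F : Fin m → Subset n)
    (F-minimal : ∀ k → IsMinimalFort G (F k))
    (F-complete : ∀ F′ → IsMinimalFort G F′ → ∃ λ k → F k ≡ F′)
    {z} (z≤ : ZAtLeast G z) where

    fortCover : ∀ C → ∃ λ D → C ⊆ D × MeetsAllForts G D × ∣ D ∣ ≤ ∣ C ∣ + missedBy F C
    fortCover C with transversal F C (proj₁ ∘ proj₁ ∘ F-minimal)
    ... | R , ∣R∣≤ , hits =
      C ∪ R , p⊆p∪q R , meetsMinimalForts⇒meetsAllForts G meetsMinimal ,
      ≤-trans (∣p∪q∣≤∣p∣+∣q∣ C R) (+-monoʳ-≤ ∣ C ∣ ∣R∣≤)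
      where
      meetsMinimal : ∀ F′ → IsMinimalFort G F′ → F′ meets (C ∪ R)
      meetsMinimal F′ minimal with F-complete F′ minimal
      ... | k , refl = hits k

    z≤∣C∣+missed : ∀ C → z ≤ ∣ C ∣ + missedBy F C
    z≤∣C∣+missed C with fortCover C
    ... | D , _ , D-meets , ∣D∣≤ = ≤-trans (meetsAllForts⇒z≤∣T∣ G z≤ D-meets) ∣D∣≤

    closedNeighbourhood⊆⇒z<∣C∣+missed : ∀ {C u x} → G u u ≡ false → ClosedNeighbourhood⊆ G u C →
                                        G u x ≡ true → z < ∣ C ∣ + missedBy F C
    closedNeighbourhood⊆⇒z<∣C∣+missed {C} uu (u∈C , N[u]⊆C) ux with fortCover C
    ... | D , C⊆D , D-meets , ∣D∣≤ =
      <-≤-trans (closedNeighbourhood⊆zfs⇒z<∣T∣ G z≤ uu (meetsAllForts⇒zfs G D-meets)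
                                               (C⊆D u∈C , C⊆D ∘ N[u]⊆C) ux)
                ∣D∣≤

    outsideForts⇒z<∣C∣+missed : ∀ {C p} → p ∈ C → (∀ k → p ∉ F k) → z < ∣ C ∣ + missedBy F C
    outsideForts⇒z<∣C∣+missed {C} {p} p∈C p∉F =
      ≤-<-trans (z≤∣C∣+missed (C - p))
        (+-mono-<-≤ (x∈p⇒∣p-x∣<∣p∣ p∈C) (missedBy-anti F meets-C-p))
      where
      meets-C-p : ∀ k → F k meets C → F k meets (C - p)
      meets-C-p k (x , x∈F , x∈C) = x , x∈F , x∈p∧x≢y⇒x∈p-y x∈C λ { refl → p∉F k x∈F }

module CartesianProduct where

  open Counting
  open ZeroForcing
  open import Data.Nat using (ℕ; _+_; _*_; _≤_; _<_)
  open import Data.Nat.Properties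
    using (+-0-commutativeMonoid; +-assoc; +-monoˡ-<; +-monoˡ-≤; +-monoʳ-≤; +-monoʳ-<; ≤-trans; ≤-<-trans)
  open import Algebra.Properties.CommutativeMonoid.Sum +-0-commutativeMonoid
    using (sum; sum-syntax; sum-cong-≗; ∑-distrib-+; ∑-comm)
  open import Data.Bool using (Bool; true; false; _∧_; _∨_)
  import Data.Bool as Bool
  open import Data.Bool.Properties using (∨-zeroʳ)
  open import Data.Fin using (Fin; combine; remQuot; _≟_)
  open import Data.Fin.Properties
    using (any?; remQuot-combine; combine-remQuot; combine-injectiveˡ; combine-injectiveʳ)
  open import Data.Fin.Subset using (Subset; _∈_; _∉_; ∣_∣; _∩_)
  open import Data.Fin.Subset.Properties using (_∈?_)
  open import Data.Product using (∃; _×_; _,_; proj₁; proj₂)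
  open import Data.Sum using (_⊎_; inj₁; inj₂)
  open import Function using (_∘_)
  open import Relation.Nullary using (yes; no; ⌊_⌋; contradiction)
  open import Relation.Nullary.Decidable using (¬?; _×-dec_; decidable-stable)
  open import Relation.Unary using (Decidable)
  open import Relation.Binary.PropositionalEquality

  module _ {n₁ n₂ : ℕ} where

    data PairView : Fin (n₁ * n₂) → Set where
      ⟨_,_⟩ : (a : Fin n₁) (b : Fin n₂) → PairView (combine a b)

    pairView : ∀ i → PairView i
    pairView i =
      subst PairView (combine-remQuot {n₁} n₂ i) ⟨ proj₁ (remQuot {n₁} n₂ i) , proj₂ (remQuot {n₁} n₂ i) ⟩

    private
      inProduct? : (F₁ : Subset n₁) (F₂ : Subset n₂) →
                   Decidable λ i → proj₁ (remQuot {n₁} n₂ i) ∈ F₁ × proj₂ (remQuot {n₁} n₂ i) ∈ F₂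
      inProduct? F₁ F₂ i = proj₁ (remQuot {n₁} n₂ i) ∈? F₁ ×-dec proj₂ (remQuot {n₁} n₂ i) ∈? F₂

    _⊠_ : Subset n₁ → Subset n₂ → Subset (n₁ * n₂)
    F₁ ⊠ F₂ = select (inProduct? F₁ F₂)

    ∈-⊠⁺ : ∀ {F₁ F₂ a b} → a ∈ F₁ → b ∈ F₂ → combine a b ∈ F₁ ⊠ F₂
    ∈-⊠⁺ {F₁} {F₂} {a} {b} a∈F₁ b∈F₂ =
      ∈-select⁺ (inProduct? F₁ F₂)
        (subst (λ (x , y) → x ∈ F₁ × y ∈ F₂) (sym (remQuot-combine {n₁} {n₂} a b)) (a∈F₁ , b∈F₂))

    ∈-⊠⁻ : ∀ {F₁ F₂ a b} → combine a b ∈ F₁ ⊠ F₂ → a ∈ F₁ × b ∈ F₂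
    ∈-⊠⁻ {F₁} {F₂} {a} {b} ab∈ =
      subst (λ (x , y) → x ∈ F₁ × y ∈ F₂) (remQuot-combine {n₁} {n₂} a b) (∈-select⁻ (inProduct? F₁ F₂) ab∈)

    layer : Subset (n₁ * n₂) → Fin n₂ → Subset n₁
    layer B b = select (λ a → combine a b ∈? B)

    shadow : Subset n₁ → Subset (n₁ * n₂) → Subset n₂
    shadow F B = select (λ b → F meets? layer B b)

    ∣B∣≡∑∣layer∣ : ∀ B → ∣ B ∣ ≡ ∑[ b < n₂ ] ∣ layer B b ∣
    ∣B∣≡∑∣layer∣ B = begin
      ∣ B ∣                                    ≡⟨ ∣p∣≡∑ B ⟩
      ∑[ i < n₁ * n₂ ] indicator (i ∈? B)      ≡⟨ ∑-combine n₁ (λ i → indicator (i ∈? B)) ⟩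
      ∑[ a < n₁ ] ∑[ b < n₂ ] inB a b          ≡⟨ ∑-comm {n₁} {n₂} inB ⟩
      ∑[ b < n₂ ] ∑[ a < n₁ ] inB a b          ≡⟨ sum-cong-≗ {n₂} (λ b → ∣select∣≡∑ (λ (a : Fin n₁) → combine a b ∈? B)) ⟨
      ∑[ b < n₂ ] ∣ layer B b ∣                ∎
      where
      open ≡-Reasoning
      inB : Fin n₁ → Fin n₂ → ℕ
      inB a b = indicator (combine a b ∈? B)

  module _ {n₁ n₂} (G₁ : Graph n₁) (G₂ : Graph n₂) where

    □-combine : ∀ a b c d →
                (G₁ □ G₂) (combine a b) (combine c d) ≡ (⌊ a ≟ c ⌋ ∧ G₂ b d) ∨ (⌊ b ≟ d ⌋ ∧ G₁ a c)
    □-combine a b c d =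
      trans (□-remQuot (combine a b) (combine c d))
            (cong₂ adjacent (remQuot-combine {n₁} {n₂} a b) (remQuot-combine {n₁} {n₂} c d))
      where
      adjacent : Fin n₁ × Fin n₂ → Fin n₁ × Fin n₂ → Bool
      adjacent (a , b) (c , d) = (⌊ a ≟ c ⌋ ∧ G₂ b d) ∨ (⌊ b ≟ d ⌋ ∧ G₁ a c)
      □-remQuot : ∀ i j → (G₁ □ G₂) i j ≡ adjacent (remQuot {n₁} n₂ i) (remQuot n₂ j)
      □-remQuot i j with remQuot {n₁} n₂ i | remQuot {n₁} n₂ j
      ... | _ | _ = refl

    data □-Edge : Fin n₁ → Fin n₂ → Fin n₁ → Fin n₂ → Set where
      vertical   : ∀ {a b d} → G₂ b d ≡ true → □-Edge a b a d
      horizontal : ∀ {a b c} → G₁ a c ≡ true → □-Edge a b c b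

    □-edge⁺ : ∀ {a b c d} → □-Edge a b c d → (G₁ □ G₂) (combine a b) (combine c d) ≡ true
    □-edge⁺ {a} {b} {.a} {d} (vertical bd) rewrite □-combine a b a d with a ≟ a
    ... | yes _   rewrite bd = refl
    ... | no a≢a  = contradiction refl a≢a
    □-edge⁺ {a} {b} {c} {.b} (horizontal ac) rewrite □-combine a b c b with b ≟ b
    ... | yes _   rewrite ac = ∨-zeroʳ _
    ... | no b≢b  = contradiction refl b≢b

    □-edge⁻ : ∀ {a b c d} → (G₁ □ G₂) (combine a b) (combine c d) ≡ true → □-Edge a b c d
    □-edge⁻ {a} {b} {c} {d} e with trans (sym (□-combine a b c d)) e
    ... | e′ with a ≟ c | b ≟ d | G₂ b d in bd | G₁ a c in ac
    ... | yes refl | _        | true  | _     = vertical bd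
    ... | _        | yes refl | _     | true  = horizontal ac
    ... | no _     | no _     | _     | _     with () ← e′
    ... | no _     | yes _    | _     | false with () ← e′
    ... | yes _    | no _     | false | _     with () ← e′
    ... | yes _    | yes _    | false | false with () ← e′

    fort⊠fort : ∀ {F₁ F₂} → IsFort G₁ F₁ → IsFort G₂ F₂ → IsFort (G₁ □ G₂) (F₁ ⊠ F₂)
    fort⊠fort {F₁} {F₂} ((a₀ , a₀∈F₁) , fort₁) ((b₀ , b₀∈F₂) , fort₂) =
      (combine a₀ b₀ , ∈-⊠⁺ a₀∈F₁ b₀∈F₂) , closed
      where
      closed : ∀ i → i ∉ F₁ ⊠ F₂ → ∣ N (G₁ □ G₂) i ∩ (F₁ ⊠ F₂) ∣ ≢ 1
      closed i i∉ ∣N∩F∣≡1 with ∣N∩F∣≡1⇒uniqueNeighbour (G₁ □ G₂) ∣N∩F∣≡1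
      ... | j , ij , j∈ , unique with pairView {n₁} {n₂} i | pairView {n₁} {n₂} j
      ... | ⟨ a , b ⟩ | ⟨ c , d ⟩ with □-edge⁻ ij | ∈-⊠⁻ j∈
      ... | vertical {d = d} bd | a∈F₁ , d∈F₂ =
        fort₂ b (λ b∈F₂ → i∉ (∈-⊠⁺ a∈F₁ b∈F₂)) (uniqueNeighbour⇒∣N∩F∣≡1 G₂ (bd , d∈F₂ , unique₂))
        where
        unique₂ : ∀ {y} → G₂ b y ≡ true → y ∈ F₂ → y ≡ d
        unique₂ by y∈F₂ = combine-injectiveʳ a _ a d (unique (□-edge⁺ (vertical by)) (∈-⊠⁺ a∈F₁ y∈F₂))
      ... | horizontal {c = c} ac | c∈F₁ , b∈F₂ =
        fort₁ a (λ a∈F₁ → i∉ (∈-⊠⁺ a∈F₁ b∈F₂)) (uniqueNeighbour⇒∣N∩F∣≡1 G₁ (ac , c∈F₁ , unique₁))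
        where
        unique₁ : ∀ {y} → G₁ a y ≡ true → y ∈ F₁ → y ≡ c
        unique₁ ay y∈F₁ = combine-injectiveˡ _ b c b (unique (□-edge⁺ (horizontal ay)) (∈-⊠⁺ y∈F₁ b∈F₂))

    zfs⇒shadowMeetsAllForts : ∀ {B F₁} → IsZeroForcingSet (G₁ □ G₂) B → IsFort G₁ F₁ →
                              MeetsAllForts G₂ (shadow F₁ B)
    zfs⇒shadowMeetsAllForts {B} {F₁} zfs fort₁ F₂ fort₂
      with zfs⇒meetsAllForts (G₁ □ G₂) zfs (F₁ ⊠ F₂) (fort⊠fort fort₁ fort₂)
    ... | j , j∈F₁⊠F₂ , j∈B with pairView {n₁} {n₂} j
    ... | ⟨ a , b ⟩ with ∈-⊠⁻ j∈F₁⊠F₂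
    ...   | a∈F₁ , b∈F₂ =
      b , b∈F₂ , ∈-select⁺ (λ b → F₁ meets? layer B b) (a , a∈F₁ , ∈-select⁺ (λ a → combine a b ∈? B) j∈B)

  <-eliminate : ∀ {a x s k p} → (a < x + s × s + k ≤ p) ⊎ (a ≤ x + s × s + k < p) → a + k < x + p
  <-eliminate {_} {x} {s} {k} {p} (inj₁ (a<x+s , s+k≤p)) =
    ≤-trans (+-monoˡ-< k a<x+s) (subst (_≤ x + p) (sym (+-assoc x s k)) (+-monoʳ-≤ x s+k≤p))
  <-eliminate {_} {x} {s} {k} {p} (inj₂ (a≤x+s , s+k<p)) =
    ≤-<-trans (+-monoˡ-≤ k a≤x+s) (subst (_< x + p) (sym (+-assoc x s k)) (+-monoʳ-< x s+k<p))

  module ProductBound {m n₁ n₂} (G₁ : Graph n₁) (G₂ : Graph n₂)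
    (simple₁ : IsSimple G₁) (simple₂ : IsSimple G₂)
    (F : Fin m → Subset n₁)
    (F-minimal : ∀ k → IsMinimalFort G₁ (F k))
    (F-complete : ∀ F′ → IsMinimalFort G₁ F′ → ∃ λ k → F k ≡ F′)
    {z₁ z₂} (z₁≤ : ZAtLeast G₁ z₁) (z₂≤ : ZAtLeast G₂ z₂)
    {B} (zfs : IsZeroForcingSet (G₁ □ G₂) B) where

    open LayerBound G₁ F F-minimal F-complete z₁≤

    C : Fin n₂ → Subset n₁
    C = layer {n₁} B

    T : Fin m → Subset n₂
    T k = shadow (F k) B

    Slack : Set
    Slack = (∃ λ b → z₁ < ∣ C b ∣ + missedBy F (C b)) ⊎ (∃ λ k → z₂ < ∣ T k ∣)

    Interior : Fin (n₁ * n₂) → Set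
    Interior i = NonIsolated G₁ (proj₁ (remQuot {n₁} n₂ i)) × NonIsolated G₂ (proj₂ (remQuot {n₁} n₂ i))

    interior⁺ : ∀ {a b} → NonIsolated G₁ a → NonIsolated G₂ b → Interior (combine a b)
    interior⁺ {a} {b} a-nonIsolated b-nonIsolated =
      subst (λ (x , y) → NonIsolated G₁ x × NonIsolated G₂ y) (sym (remQuot-combine {n₁} {n₂} a b))
        (a-nonIsolated , b-nonIsolated)

    interior⁻ : ∀ {a b} → Interior (combine a b) → NonIsolated G₁ a × NonIsolated G₂ b
    interior⁻ {a} {b} =
      subst (λ (x , y) → NonIsolated G₁ x × NonIsolated G₂ y) (remQuot-combine {n₁} {n₂} a b)

    interior-closed : AdjacencyClosed (G₁ □ G₂) Interior
    interior-closed {i} {j} ij with pairView {n₁} {n₂} i | pairView {n₁} {n₂} j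
    ... | ⟨ a , b ⟩ | ⟨ c , d ⟩ with □-edge⁻ G₁ G₂ ij
    ... | vertical bd =
      (λ ab → interior⁺ (proj₁ (interior⁻ ab)) (b , trans (proj₁ simple₂ d b) bd)) ,
      (λ ad → interior⁺ (proj₁ (interior⁻ ad)) (d , bd))
    ... | horizontal ac =
      (λ ab → interior⁺ (a , trans (proj₁ simple₁ c a) ac) (proj₂ (interior⁻ ab))) ,
      (λ cb → interior⁺ (c , ac) (proj₂ (interior⁻ cb)))

    T-meetsAllForts : ∀ k → MeetsAllForts G₂ (T k)
    T-meetsAllForts k = zfs⇒shadowMeetsAllForts G₁ G₂ zfs (proj₁ (F-minimal k))

    ∈C⁺ : ∀ {a b} → combine a b ∈ B → a ∈ C b
    ∈C⁺ {b = b} = ∈-select⁺ (λ a → combine a b ∈? B)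

    ∈T⁺ : ∀ {k a b} → a ∈ F k → combine a b ∈ B → b ∈ T k
    ∈T⁺ {k} a∈F ab∈B = ∈-select⁺ (λ b → F k meets? C b) (_ , a∈F , ∈C⁺ ab∈B)

    initialForce⇒slack : ∀ {u w} → Interior u → InitialForce (G₁ □ G₂) B u w → Slack
    initialForce⇒slack {u} {w} u-interior (u∈B , uw , others) with pairView {n₁} {n₂} u | pairView {n₁} {n₂} w
    ... | ⟨ a , b ⟩ | ⟨ c , d ⟩ with □-edge⁻ G₁ G₂ uw
    ... | vertical bd = inj₁ (b , closedNeighbourhood⊆⇒z<∣C∣+missed (proj₂ simple₁ a) (∈C⁺ u∈B , N[a]⊆) ac)
      where
      ac : G₁ a (proj₁ (proj₁ (interior⁻ u-interior))) ≡ true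
      ac = proj₂ (proj₁ (interior⁻ u-interior))
      b≢d : b ≢ d
      b≢d refl with () ← trans (sym bd) (proj₂ simple₂ b)
      N[a]⊆ : ∀ {y} → G₁ a y ≡ true → y ∈ C b
      N[a]⊆ {y} ay = ∈C⁺ (others (□-edge⁺ G₁ G₂ (horizontal ay)) (b≢d ∘ combine-injectiveʳ y b a d))
    ... | horizontal ac with any? (λ k → a ∈? F k)
    ...   | yes (k , a∈F) =
      inj₂ (k , closedNeighbourhood⊆zfs⇒z<∣T∣ G₂ z₂≤ (proj₂ simple₂ b) (meetsAllForts⇒zfs G₂ (T-meetsAllForts k))
                                               (∈T⁺ a∈F u∈B , ∈T⁺ a∈F ∘ N[b]⊆) bd)
      where
      bd : G₂ b (proj₁ (proj₂ (interior⁻ u-interior))) ≡ true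
      bd = proj₂ (proj₂ (interior⁻ u-interior))
      a≢c : a ≢ c
      a≢c refl with () ← trans (sym ac) (proj₂ simple₁ a)
      N[b]⊆ : ∀ {y} → G₂ b y ≡ true → combine a y ∈ B
      N[b]⊆ {y} by = others (□-edge⁺ G₁ G₂ (vertical by)) (a≢c ∘ combine-injectiveˡ a y c b)
    ...   | no a∉F = inj₁ (b , outsideForts⇒z<∣C∣+missed (∈C⁺ u∈B) λ k a∈F → a∉F (k , a∈F))

    outsideInterior⇒slack : ∀ {v} → Interior v → v ∉ B → Slack
    outsideInterior⇒slack {v} v-interior v∉B
      with filled⇒initialForce (G₁ □ G₂) interior-closed (zfs v) v-interior
    ... | inj₁ v∈B = contradiction v∈B v∉B
    ... | inj₂ (u , w , u-interior , initial) = initialForce⇒slack u-interior initial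

    slack : HasEdge G₁ → HasEdge G₂ → Slack
    slack (a , c , ac) (b , d , bd) with combine a b ∈? B
    ... | no ab∉B = outsideInterior⇒slack (interior⁺ (c , ac) (d , bd)) ab∉B
    ... | yes ab∈B with any? (λ x → (G₁ a x Bool.≟ true) ×-dec ¬? (combine x b ∈? B))
    ...   | yes (x , ax , xb∉B) =
      outsideInterior⇒slack (interior⁺ (a , trans (proj₁ simple₁ x a) ax) (d , bd)) xb∉B
    ...   | no ¬escape = inj₁ (b , closedNeighbourhood⊆⇒z<∣C∣+missed (proj₂ simple₁ a) (∈C⁺ ab∈B , N[a]⊆) ac)
      where
      N[a]⊆ : ∀ {y} → G₁ a y ≡ true → y ∈ C b
      N[a]⊆ {y} ay = ∈C⁺ (decidable-stable (combine y b ∈? B) λ yb∉B → ¬escape (y , ay , yb∉B))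

    missedIn : Fin m → Fin n₂ → ℕ
    missedIn k b = indicator (¬? (F k meets? C b))

    S : ℕ
    S = ∑[ b < n₂ ] missedBy F (C b)

    ∑layers : ∑[ b < n₂ ] (∣ C b ∣ + missedBy F (C b)) ≡ ∣ B ∣ + S
    ∑layers = trans (∑-distrib-+ (λ b → ∣ C b ∣) (λ b → missedBy F (C b)))
                    (cong (_+ S) (sym (∣B∣≡∑∣layer∣ {n₁} {n₂} B)))

    ∑forts : ∑[ k < m ] (∑[ b < n₂ ] missedIn k b + z₂) ≡ S + m * z₂
    ∑forts = trans (∑-distrib-+ (λ k → ∑[ b < n₂ ] missedIn k b) (λ _ → z₂))
                   (cong₂ _+_ (∑-comm missedIn) (∑-const m z₂))

    layerBound : ∀ b → z₁ ≤ ∣ C b ∣ + missedBy F (C b)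
    layerBound b = z≤∣C∣+missed (C b)

    fortBound : ∀ k → ∑[ b < n₂ ] missedIn k b + z₂ ≤ n₂
    fortBound k = subst (∑[ b < n₂ ] missedIn k b + z₂ ≤_) (∑indicator¬+∣select∣≡n (λ b → F k meets? C b))
      (+-monoʳ-≤ (∑[ b < n₂ ] missedIn k b) (meetsAllForts⇒z≤∣T∣ G₂ z₂≤ (T-meetsAllForts k)))

    fortBound< : ∀ k → z₂ < ∣ T k ∣ → ∑[ b < n₂ ] missedIn k b + z₂ < n₂
    fortBound< k z₂<∣T∣ =
      subst (∑[ b < n₂ ] missedIn k b + z₂ <_) (∑indicator¬+∣select∣≡n (λ b → F k meets? C b))
      (+-monoʳ-< (∑[ b < n₂ ] missedIn k b) z₂<∣T∣)

    n₂z₁≤∣B∣+S : n₂ * z₁ ≤ ∣ B ∣ + S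
    n₂z₁≤∣B∣+S = subst₂ _≤_ (∑-const n₂ z₁) ∑layers (∑-mono-≤ layerBound)

    n₂z₁<∣B∣+S : ∀ b → z₁ < ∣ C b ∣ + missedBy F (C b) → n₂ * z₁ < ∣ B ∣ + S
    n₂z₁<∣B∣+S b strict = subst₂ _<_ (∑-const n₂ z₁) ∑layers (∑-mono-< layerBound b strict)

    S+mz₂≤mn₂ : S + m * z₂ ≤ m * n₂
    S+mz₂≤mn₂ = subst₂ _≤_ ∑forts (∑-const m n₂) (∑-mono-≤ fortBound)

    S+mz₂<mn₂ : ∀ k → z₂ < ∣ T k ∣ → S + m * z₂ < m * n₂
    S+mz₂<mn₂ k strict = subst₂ _<_ ∑forts (∑-const m n₂) (∑-mono-< fortBound k (fortBound< k strict))

    n₂z₁+mz₂<∣B∣+mn₂ : HasEdge G₁ → HasEdge G₂ → n₂ * z₁ + m * z₂ < ∣ B ∣ + m * n₂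
    n₂z₁+mz₂<∣B∣+mn₂ edge₁ edge₂ with slack edge₁ edge₂
    ... | inj₁ (b , strict) = <-eliminate (inj₁ (n₂z₁<∣B∣+S b strict , S+mz₂≤mn₂))
    ... | inj₂ (k , strict) = <-eliminate (inj₂ (n₂z₁≤∣B∣+S , S+mz₂<mn₂ k strict))

open CartesianProduct using (module ProductBound)
open import Data.Nat using (suc; _<_)
import Data.Nat as ℕ
open import Data.Integer using (+_; _+_; _-_; _*_; _≥_; -_; +≤+)
open import Data.Integer.Properties using (pos-+; pos-*; +-monoˡ-≤; module ≤-Reasoning)
open import Data.Integer.Tactic.RingSolver using (solve-∀)
open import Data.List using (length; lookup)
open import Data.List.Membership.Propositional using (_∈_)
open import Data.List.Membership.Propositional.Properties using (∈-lookup)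
open import Data.List.Relation.Unary.Any using (index)
open import Data.List.Relation.Unary.Any.Properties using (lookup-index)
open import Data.Product using (∃; _,_; proj₁; proj₂)
open import Relation.Binary.PropositionalEquality

ℕ-bound⇒ℤ-bound : ∀ n₂ z₁ z₂ z₁₂ m → n₂ ℕ.* z₁ ℕ.+ m ℕ.* z₂ < z₁₂ ℕ.+ m ℕ.* n₂ →
                  + z₁₂ ≥ (+ n₂ * + z₁) - (+ m * (+ n₂ - + z₂)) + + 1
ℕ-bound⇒ℤ-bound n₂ z₁ z₂ z₁₂ m bound = begin
  + n₂ * + z₁ - + m * (+ n₂ - + z₂) + + 1          ≡⟨ regroup (+ n₂) (+ z₁) (+ m) (+ z₂) ⟩
  + 1 + (+ n₂ * + z₁ + + m * + z₂) - + m * + n₂     ≡⟨ cong (_- + m * + n₂) cast-lhs ⟨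
  + suc (n₂ ℕ.* z₁ ℕ.+ m ℕ.* z₂) - + m * + n₂       ≤⟨ +-monoˡ-≤ (- (+ m * + n₂)) (+≤+ bound) ⟩
  + (z₁₂ ℕ.+ m ℕ.* n₂) - + m * + n₂                 ≡⟨ cong (_- + m * + n₂) cast-rhs ⟩
  + z₁₂ + + m * + n₂ - + m * + n₂                   ≡⟨ cancel (+ z₁₂) (+ m * + n₂) ⟩
  + z₁₂                                             ∎
  where
  open ≤-Reasoning
  regroup : ∀ a b c d → a * b - c * (a - d) + + 1 ≡ + 1 + (a * b + c * d) - c * a
  regroup = solve-∀
  cancel : ∀ z p → z + p - p ≡ z
  cancel = solve-∀
  cast-lhs : + suc (n₂ ℕ.* z₁ ℕ.+ m ℕ.* z₂) ≡ + 1 + (+ n₂ * + z₁ + + m * + z₂)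
  cast-lhs = trans (pos-+ 1 _)
    (cong (_+_ (+ 1)) (trans (pos-+ (n₂ ℕ.* z₁) _) (cong₂ _+_ (pos-* n₂ z₁) (pos-* m z₂))))
  cast-rhs : + (z₁₂ ℕ.+ m ℕ.* n₂) ≡ + z₁₂ + + m * + n₂
  cast-rhs = trans (pos-+ z₁₂ _) (cong (_+_ (+ z₁₂)) (pos-* m n₂))

proposition4p19 : (n₁ n₂ : ℕ) (G₁ : Graph n₁) (G₂ : Graph n₂) →
    IsSimple G₁ → IsSimple G₂ → HasEdge G₁ → HasEdge G₂ →
    (z₁ z₂ z₁₂ m : ℕ) → IsZ G₁ z₁ → IsZ G₂ z₂ → IsZ (G₁ □ G₂) z₁₂ →
    NumMinimalForts G₁ m →
    + z₁₂ ≥ (+ n₂ * + z₁) - (+ m * (+ n₂ - + z₂)) + + 1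
proposition4p19 n₁ n₂ G₁ G₂ simple₁ simple₂ edge₁ edge₂ z₁ z₂ _ _ Z₁ Z₂ ((B , zfs , refl) , _)
  (L , _ , listsMinimalForts , refl) =
  ℕ-bound⇒ℤ-bound n₂ z₁ z₂ _ (length L) (n₂z₁+mz₂<∣B∣+mn₂ edge₁ edge₂)
  where
  complete : ∀ F → IsMinimalFort G₁ F → ∃ λ k → lookup L k ≡ F
  complete F minimal = index F∈L , sym (lookup-index F∈L)
    where
    F∈L : F ∈ L
    F∈L = proj₂ (listsMinimalForts F) minimal
  open ProductBound G₁ G₂ simple₁ simple₂ (lookup L) (λ k → proj₁ (listsMinimalForts _) (∈-lookup k))
    complete (proj₂ Z₁) (proj₂ Z₂) zfs
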